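{- Let $G$ be a finite connected simple graph with $n$ vertices and $m$ edges, and let $k\ge 1$ be an integer. Then \[HM(R_k(G))=(k+1)^2HM(G)+k(k+1)^2F(G)+4k(k+1)M_1(G)+8km.\]
   Context: For a graph $H$ and vertex $v$, $d_H(v)$ denotes the degree of $v$ in $H$. Define $M_1(H)=\sum_{v\in V(H)} d_H(v)^2$, $F(H)=\sum_{v\in V(H)} d_H(v)^3$ and $HM(H)=\sum_{uv\in E(H)}(d_H(u)+d_H(v))^2$. The $k$-th semi total point graph $R_k(G)$ is obtained from $G$ by adding, for each edge $uv$ of $G$, $k$ new vertices (distinct for distinct edges) and joining each of them to both $u$ and $v$ (the edges of $G$ are kept). -}

module Defs where

open import Data.Nat using (ℕ; zero; suc; _+_; _*_; _^_)
open import Data.Fin as Fin using (Fin; _↑ˡ_; _↑ʳ_; combine)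
open import Data.Nat.ListAction using (sum)
open import Data.List using (List; []; _∷_; _++_; map; length; lookup; allFin; concatMap)
open import Data.List.Membership.Propositional using (_∈_)
open import Data.List.Relation.Unary.All using (All)
open import Data.List.Relation.Unary.AllPairs using (AllPairs)
open import Data.Product using (_×_; _,_; proj₁; proj₂)
open import Data.Sum using (_⊎_)
open import Relation.Nullary using (¬_; does)
open import Relation.Binary.PropositionalEquality using (_≡_; _≢_)
open import Data.Bool using (if_then_else_)

record Graph : Set where
  constructor mkGraph
  field
    n     : ℕ
    edges : List (Fin n × Fin n)

open Graph public

numEdges : Graph → ℕ
numEdges G = length (edges G)

SameEdge : ∀ {n} → Fin n × Fin n → Fin n × Fin n → Set
SameEdge (a , b) (c , d) = (a ≡ c × b ≡ d) ⊎ (a ≡ d × b ≡ c)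

Simple : Graph → Set
Simple G = All (λ e → proj₁ e ≢ proj₂ e) (edges G)
         × AllPairs (λ e e' → ¬ SameEdge e e') (edges G)

Adjacent : (G : Graph) → Fin (n G) → Fin (n G) → Set
Adjacent G u w = ((u , w) ∈ edges G) ⊎ ((w , u) ∈ edges G)

data Reach (G : Graph) : Fin (n G) → Fin (n G) → Set where
  here : ∀ {v} → Reach G v v
  step : ∀ {u w v} → Adjacent G u w → Reach G w v → Reach G u v

Connected : Graph → Set
Connected G = ∀ u v → Reach G u v

ind : ∀ {n} → Fin n → Fin n → ℕ
ind a b = if does (a Fin.≟ b) then 1 else 0

deg : (G : Graph) → Fin (n G) → ℕ
deg G v = sum (map (λ e → ind (proj₁ e) v + ind (proj₂ e) v) (edges G))

M1 : Graph → ℕ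
M1 G = sum (map (λ v → deg G v ^ 2) (allFin (n G)))

F : Graph → ℕ
F G = sum (map (λ v → deg G v ^ 3) (allFin (n G)))

HM : Graph → ℕ
HM G = sum (map (λ e → (deg G (proj₁ e) + deg G (proj₂ e)) ^ 2) (edges G))

-- k-th semi total point graph.  Vertices: Fin (n + m * k); the old vertex u
-- is u ↑ˡ (m * k), the j-th new vertex of edge number i is n ↑ʳ combine i j.
R : ℕ → Graph → Graph
R k G = mkGraph (n G + m * k) (oldEdges ++ newEdges)
  where
    m = numEdges G
    old : Fin (n G) → Fin (n G + m * k)
    old u = u ↑ˡ (m * k)
    new : Fin m → Fin k → Fin (n G + m * k)
    new i j = n G ↑ʳ combine i j
    oldEdges = map (λ e → old (proj₁ e) , old (proj₂ e)) (edges G)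
    newEdgesOf : Fin m → List (Fin (n G + m * k) × Fin (n G + m * k))
    newEdgesOf i = concatMap (λ j → (old (proj₁ (lookup (edges G) i)) , new i j)
                                  ∷ (old (proj₂ (lookup (edges G) i)) , new i j) ∷ [])
                             (allFin k)
    newEdges = concatMap newEdgesOf (allFin m)

module Submission where

open import Defs
open import Data.Nat using (ℕ; suc; _+_; _*_; _^_; _≥_)
open import Data.Nat.Properties using (+-identityʳ; *-zeroʳ; *-distribˡ-+; *-distribʳ-+; *-comm)
open import Data.Nat.ListAction using (sum)
open import Data.Nat.ListAction.Properties using (sum-++)
open import Data.Nat.Solver using (module +-*-Solver)
open import Data.Fin as Fin using (Fin; _↑ˡ_; _↑ʳ_; combine)
open import Data.Fin.Properties using (suc-injective; ↑ˡ-injective; ↑ʳ-injective; combine-injectiveˡ; combine-injectiveʳ)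
open import Data.List using (List; []; _∷_; _++_; map; length; lookup; allFin; concatMap; tabulate)
open import Data.List.Properties using (map-++; map-∘; map-tabulate; tabulate-lookup; length-tabulate)
open import Data.Product using (_×_; _,_; proj₁; proj₂)
open import Function using (_∘_; id)
open import Function.Definitions using (Injective)
open import Relation.Nullary using (yes; no)
open import Relation.Nullary.Decidable using (dec-true; dec-false)
open import Data.Bool using (if_then_else_)
open import Relation.Binary.PropositionalEquality

open +-*-Solver

-- Every old vertex v of R_k(G) has degree (k+1) d(v) and every new vertex has
-- degree 2, so an edge joining v to a new vertex has degree sum
-- s(v) = (k+1) d(v) + 2.  Hence the old edges contribute (k+1)² HM(G) and the k new
-- vertices over an edge uv contribute k (s(u)² + s(v)²).  By the handshake lemma,
-- summing s² over the ends of all edges is summing d(v) s(v)² over the vertices;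
-- expanding d ((k+1) d + 2)² and using Σ d(v) = 2m gives the formula.

private
  variable
    A B : Set

∑ : List A → (A → ℕ) → ℕ
∑ xs f = sum (map f xs)

syntax ∑ xs (λ x → e) = ∑[ x ∈ xs ] e

∑-++ : (xs ys : List A) (f : A → ℕ) → ∑ (xs ++ ys) f ≡ ∑ xs f + ∑ ys f
∑-++ xs ys f = trans (cong sum (map-++ f xs ys)) (sum-++ (map f xs) (map f ys))

∑-map : (g : A → B) (xs : List A) (f : B → ℕ) → ∑ (map g xs) f ≡ ∑ xs (f ∘ g)
∑-map g xs f = cong sum (sym (map-∘ xs))

∑-concatMap : (g : A → List B) (xs : List A) (f : B → ℕ) →
              ∑ (concatMap g xs) f ≡ ∑[ x ∈ xs ] ∑ (g x) f
∑-concatMap g []       f = refl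
∑-concatMap g (x ∷ xs) f =
  trans (∑-++ (g x) (concatMap g xs) f) (cong (∑ (g x) f +_) (∑-concatMap g xs f))

∑-cong : (xs : List A) {f g : A → ℕ} → (∀ x → f x ≡ g x) → ∑ xs f ≡ ∑ xs g
∑-cong []       eq = refl
∑-cong (x ∷ xs) eq = cong₂ _+_ (eq x) (∑-cong xs eq)

∑-+ : (xs : List A) (f g : A → ℕ) → ∑[ x ∈ xs ] (f x + g x) ≡ ∑ xs f + ∑ xs g
∑-+ []       f g = refl
∑-+ (x ∷ xs) f g rewrite ∑-+ xs f g =
  solve 4 (λ a b c d → (a :+ b) :+ (c :+ d) := (a :+ c) :+ (b :+ d)) refl (f x) (g x) (∑ xs f) (∑ xs g)

∑-*ˡ : (xs : List A) (c : ℕ) (f : A → ℕ) → ∑[ x ∈ xs ] (c * f x) ≡ c * ∑ xs f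
∑-*ˡ []       c f = sym (*-zeroʳ c)
∑-*ˡ (x ∷ xs) c f = trans (cong (c * f x +_) (∑-*ˡ xs c f)) (sym (*-distribˡ-+ c (f x) _))

∑-*ʳ : (xs : List A) (f : A → ℕ) (c : ℕ) → ∑[ x ∈ xs ] (f x * c) ≡ ∑ xs f * c
∑-*ʳ xs f c = trans (∑-cong xs (λ x → *-comm (f x) c)) (trans (∑-*ˡ xs c f) (*-comm c (∑ xs f)))

∑-const : (xs : List A) (c : ℕ) → ∑[ _ ∈ xs ] c ≡ length xs * c
∑-const []       c = refl
∑-const (x ∷ xs) c = cong (c +_) (∑-const xs c)

∑-zero : (xs : List A) → ∑[ _ ∈ xs ] 0 ≡ 0
∑-zero xs = trans (∑-const xs 0) (*-zeroʳ (length xs))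

∑-swap : (xs : List A) (ys : List B) (f : A → B → ℕ) →
         ∑[ x ∈ xs ] ∑ ys (f x) ≡ ∑[ y ∈ ys ] ∑[ x ∈ xs ] f x y
∑-swap []       ys f = sym (∑-zero ys)
∑-swap (x ∷ xs) ys f =
  trans (cong (∑ ys (f x) +_) (∑-swap xs ys f)) (sym (∑-+ ys (f x) (λ y → ∑[ x′ ∈ xs ] f x′ y)))

∑-allFin-suc : ∀ n (f : Fin (suc n) → ℕ) → ∑ (allFin (suc n)) f ≡ f Fin.zero + ∑ (allFin n) (f ∘ Fin.suc)
∑-allFin-suc n f =
  cong (f Fin.zero +_) (cong sum (trans (map-tabulate Fin.suc f) (sym (map-tabulate id (f ∘ Fin.suc)))))

∑-allFin-lookup : (xs : List A) (h : A → ℕ) → ∑[ i ∈ allFin (length xs) ] h (lookup xs i) ≡ ∑ xs h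
∑-allFin-lookup xs h = cong sum (begin
  map (h ∘ lookup xs) (tabulate id) ≡⟨ map-tabulate id (h ∘ lookup xs) ⟩
  tabulate (h ∘ lookup xs)          ≡⟨ map-tabulate (lookup xs) h ⟨
  map h (tabulate (lookup xs))      ≡⟨ cong (map h) (tabulate-lookup xs) ⟩
  map h xs                          ∎)
  where open ≡-Reasoning

∑-allFin-lookup-repeated : (xs : List A) (k : ℕ) (h : A → ℕ) →
  ∑[ i ∈ allFin (length xs) ] ∑[ _ ∈ allFin k ] h (lookup xs i) ≡ k * ∑ xs h
∑-allFin-lookup-repeated xs k h = begin
  ∑[ i ∈ allFin (length xs) ] ∑[ _ ∈ allFin k ] h (lookup xs i)
    ≡⟨ ∑-cong (allFin (length xs)) (λ i → ∑-const (allFin k) (h (lookup xs i))) ⟩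
  ∑[ i ∈ allFin (length xs) ] (length (allFin k) * h (lookup xs i))
    ≡⟨ ∑-*ˡ (allFin (length xs)) (length (allFin k)) (h ∘ lookup xs) ⟩
  length (allFin k) * ∑[ i ∈ allFin (length xs) ] h (lookup xs i)
    ≡⟨ cong₂ _*_ (length-tabulate {n = k} id) (∑-allFin-lookup xs h) ⟩
  k * ∑ xs h ∎
  where open ≡-Reasoning

ind-refl : ∀ {n} (a : Fin n) → ind a a ≡ 1
ind-refl a = cong (λ b → if b then 1 else 0) (dec-true (a Fin.≟ a) refl)

ind-≢ : ∀ {n} {a b : Fin n} → a ≢ b → ind a b ≡ 0
ind-≢ {a = a} {b} a≢b = cong (λ c → if c then 1 else 0) (dec-false (a Fin.≟ b) a≢b)

ind-sym : ∀ {n} (a b : Fin n) → ind a b ≡ ind b a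
ind-sym a b with a Fin.≟ b
... | yes refl = sym (ind-refl a)
... | no a≢b   = sym (ind-≢ (a≢b ∘ sym))

ind-injective : ∀ {n p} {f : Fin n → Fin p} → Injective _≡_ _≡_ f → ∀ a b → ind (f a) (f b) ≡ ind a b
ind-injective {f = f} f-inj a b with a Fin.≟ b
... | yes refl = ind-refl (f a)
... | no a≢b   = ind-≢ (a≢b ∘ f-inj)

ind-combine : ∀ {m k} (i i′ : Fin m) (j j′ : Fin k) →
              ind (combine i j) (combine i′ j′) ≡ ind i i′ * ind j j′
ind-combine i i′ j j′ with i Fin.≟ i′ | j Fin.≟ j′
... | yes refl | yes refl = ind-refl (combine i j)
... | no i≢i′  | _        = ind-≢ (i≢i′ ∘ combine-injectiveˡ i j i′ j′)
... | yes refl | no j≢j′  = ind-≢ (j≢j′ ∘ combine-injectiveʳ i j i j′)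

↑ˡ≢↑ʳ : ∀ {m n} (i : Fin m) (j : Fin n) → i ↑ˡ n ≢ m ↑ʳ j
↑ˡ≢↑ʳ Fin.zero    j ()
↑ˡ≢↑ʳ (Fin.suc i) j eq = ↑ˡ≢↑ʳ i j (suc-injective eq)

∑-ind-* : ∀ n (a : Fin n) (g : Fin n → ℕ) → ∑[ v ∈ allFin n ] (ind a v * g v) ≡ g a
∑-ind-* (suc n) Fin.zero g = begin
  ∑[ v ∈ allFin (suc n) ] (ind Fin.zero v * g v)   ≡⟨ ∑-allFin-suc n _ ⟩
  g Fin.zero + 0 + ∑[ _ ∈ allFin n ] 0             ≡⟨ cong₂ _+_ (+-identityʳ (g Fin.zero)) (∑-zero (allFin n)) ⟩
  g Fin.zero + 0                                  ≡⟨ +-identityʳ (g Fin.zero) ⟩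
  g Fin.zero                                      ∎
  where open ≡-Reasoning
∑-ind-* (suc n) (Fin.suc a) g = trans (∑-allFin-suc n (λ v → ind (Fin.suc a) v * g v)) (∑-ind-* n a (g ∘ Fin.suc))

handshake : (G : Graph) (g : Fin (n G) → ℕ) →
  ∑[ e ∈ edges G ] (g (proj₁ e) + g (proj₂ e)) ≡ ∑[ v ∈ allFin (n G) ] (deg G v * g v)
handshake G g = sym (begin
  ∑[ v ∈ allFin (n G) ] (deg G v * g v)
    ≡⟨ ∑-cong (allFin (n G)) (λ v → trans (sym (∑-*ʳ (edges G) _ (g v)))
                                          (∑-cong (edges G) (λ e → *-distribʳ-+ (g v) (ind (proj₁ e) v) _))) ⟩
  ∑[ v ∈ allFin (n G) ] ∑[ e ∈ edges G ] (ind (proj₁ e) v * g v + ind (proj₂ e) v * g v)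
    ≡⟨ ∑-swap (allFin (n G)) (edges G) _ ⟩
  ∑[ e ∈ edges G ] ∑[ v ∈ allFin (n G) ] (ind (proj₁ e) v * g v + ind (proj₂ e) v * g v)
    ≡⟨ ∑-cong (edges G) (λ e → trans (∑-+ (allFin (n G)) _ _)
                                     (cong₂ _+_ (∑-ind-* (n G) (proj₁ e) g) (∑-ind-* (n G) (proj₂ e) g))) ⟩
  ∑[ e ∈ edges G ] (g (proj₁ e) + g (proj₂ e)) ∎)
  where open ≡-Reasoning

∑-deg : (G : Graph) → ∑[ v ∈ allFin (n G) ] (deg G v * 1) ≡ 2 * numEdges G
∑-deg G = trans (sym (handshake G (λ _ → 1))) (trans (∑-const (edges G) 2) (*-comm (numEdges G) 2))

module SemiTotal (G : Graph) (k : ℕ) where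

  private
    m : ℕ
    m = numEdges G

  old : Fin (n G) → Fin (n (R k G))
  old u = u ↑ˡ (m * k)

  new : Fin m → Fin k → Fin (n (R k G))
  new i j = n G ↑ʳ combine i j

  endˡ endʳ : Fin m → Fin (n G)
  endˡ i = proj₁ (lookup (edges G) i)
  endʳ i = proj₂ (lookup (edges G) i)

  ∑-edges : (f : Fin (n (R k G)) → Fin (n (R k G)) → ℕ) →
    ∑[ e ∈ edges (R k G) ] f (proj₁ e) (proj₂ e)
      ≡ ∑[ e ∈ edges G ] f (old (proj₁ e)) (old (proj₂ e))
        + ∑[ i ∈ allFin m ] ∑[ j ∈ allFin k ] (f (old (endˡ i)) (new i j) + f (old (endʳ i)) (new i j))
  ∑-edges f = begin
    ∑ (oldEdges ++ concatMap newEdgesOf (allFin m)) f′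
      ≡⟨ ∑-++ oldEdges (concatMap newEdgesOf (allFin m)) f′ ⟩
    ∑ oldEdges f′ + ∑ (concatMap newEdgesOf (allFin m)) f′
      ≡⟨ cong₂ _+_ (∑-map (λ e → old (proj₁ e) , old (proj₂ e)) (edges G) f′)
                   (trans (∑-concatMap newEdgesOf (allFin m) f′)
                          (∑-cong (allFin m) λ i → trans (∑-concatMap (spokes i) (allFin k) f′)
                                                         (∑-cong (allFin k) λ j → cong (f′ (old (endˡ i) , new i j) +_)
                                                                                       (+-identityʳ _)))) ⟩
    ∑[ e ∈ edges G ] f (old (proj₁ e)) (old (proj₂ e))
      + ∑[ i ∈ allFin m ] ∑[ j ∈ allFin k ] (f (old (endˡ i)) (new i j) + f (old (endʳ i)) (new i j)) ∎
    where
      open ≡-Reasoning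
      f′ : Fin (n (R k G)) × Fin (n (R k G)) → ℕ
      f′ e = f (proj₁ e) (proj₂ e)
      oldEdges : List (Fin (n (R k G)) × Fin (n (R k G)))
      oldEdges = map (λ e → old (proj₁ e) , old (proj₂ e)) (edges G)
      spokes : Fin m → Fin k → List (Fin (n (R k G)) × Fin (n (R k G)))
      spokes i j = (old (endˡ i) , new i j) ∷ (old (endʳ i) , new i j) ∷ []
      newEdgesOf : Fin m → List (Fin (n (R k G)) × Fin (n (R k G)))
      newEdgesOf i = concatMap (spokes i) (allFin k)

  ind-old : ∀ a b → ind (old a) (old b) ≡ ind a b
  ind-old = ind-injective (λ {a} {b} → ↑ˡ-injective (m * k) a b)

  ind-old-new : ∀ u i j → ind (old u) (new i j) ≡ 0
  ind-old-new u i j = ind-≢ (↑ˡ≢↑ʳ u (combine i j))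

  ind-new-old : ∀ i j u → ind (new i j) (old u) ≡ 0
  ind-new-old i j u = ind-≢ (↑ˡ≢↑ʳ u (combine i j) ∘ sym)

  ind-new : ∀ i j i′ j′ → ind (new i j) (new i′ j′) ≡ ind i i′ * ind j j′
  ind-new i j i′ j′ =
    trans (ind-injective (λ {a} {b} → ↑ʳ-injective (n G) a b) (combine i j) (combine i′ j′)) (ind-combine i i′ j j′)

  deg-old : ∀ u → deg (R k G) (old u) ≡ (k + 1) * deg G u
  deg-old u = begin
    deg (R k G) (old u)
      ≡⟨ ∑-edges (λ a b → ind a (old u) + ind b (old u)) ⟩
    ∑[ e ∈ edges G ] (ind (old (proj₁ e)) (old u) + ind (old (proj₂ e)) (old u))
      + ∑[ i ∈ allFin m ] ∑[ j ∈ allFin k ] spoke i j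
      ≡⟨ cong₂ _+_ (∑-cong (edges G) λ e → cong₂ _+_ (ind-old (proj₁ e) u) (ind-old (proj₂ e) u))
                   (∑-cong (allFin m) λ i → ∑-cong (allFin k) λ j → spoke≡ i j) ⟩
    deg G u + ∑[ i ∈ allFin m ] ∑[ _ ∈ allFin k ] (ind (endˡ i) u + ind (endʳ i) u)
      ≡⟨ cong (deg G u +_) (∑-allFin-lookup-repeated (edges G) k (λ e → ind (proj₁ e) u + ind (proj₂ e) u)) ⟩
    deg G u + k * deg G u
      ≡⟨ solve 2 (λ d k → d :+ k :* d := (k :+ con 1) :* d) refl (deg G u) k ⟩
    (k + 1) * deg G u ∎
    where
      open ≡-Reasoning
      spoke : Fin m → Fin k → ℕ
      spoke i j = ind (old (endˡ i)) (old u) + ind (new i j) (old u)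
                + (ind (old (endʳ i)) (old u) + ind (new i j) (old u))
      end≡ : ∀ i j x → ind (old x) (old u) + ind (new i j) (old u) ≡ ind x u
      end≡ i j x = trans (cong₂ _+_ (ind-old x u) (ind-new-old i j u)) (+-identityʳ (ind x u))
      spoke≡ : ∀ i j → spoke i j ≡ ind (endˡ i) u + ind (endʳ i) u
      spoke≡ i j = cong₂ _+_ (end≡ i j (endˡ i)) (end≡ i j (endʳ i))

  deg-new : ∀ i₀ j₀ → deg (R k G) (new i₀ j₀) ≡ 2
  deg-new i₀ j₀ = begin
    deg (R k G) (new i₀ j₀)
      ≡⟨ ∑-edges (λ a b → ind a (new i₀ j₀) + ind b (new i₀ j₀)) ⟩
    ∑[ e ∈ edges G ] (ind (old (proj₁ e)) (new i₀ j₀) + ind (old (proj₂ e)) (new i₀ j₀))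
      + ∑[ i ∈ allFin m ] ∑[ j ∈ allFin k ] spoke i j
      ≡⟨ cong₂ _+_ (trans (∑-cong (edges G) λ e → cong₂ _+_ (ind-old-new (proj₁ e) i₀ j₀)
                                                              (ind-old-new (proj₂ e) i₀ j₀))
                          (∑-zero (edges G)))
                   (∑-cong (allFin m) λ i → ∑-cong (allFin k) λ j → spoke≡ i j) ⟩
    ∑[ i ∈ allFin m ] ∑[ j ∈ allFin k ] (ind i₀ i * (ind j₀ j * 2))
      ≡⟨ ∑-cong (allFin m) (λ i → trans (∑-*ˡ (allFin k) (ind i₀ i) _)
                                        (cong (ind i₀ i *_) (∑-ind-* k j₀ (λ _ → 2)))) ⟩
    ∑[ i ∈ allFin m ] (ind i₀ i * 2)
      ≡⟨ ∑-ind-* m i₀ (λ _ → 2) ⟩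
    2 ∎
    where
      open ≡-Reasoning
      spoke : Fin m → Fin k → ℕ
      spoke i j = ind (old (endˡ i)) (new i₀ j₀) + ind (new i j) (new i₀ j₀)
                + (ind (old (endʳ i)) (new i₀ j₀) + ind (new i j) (new i₀ j₀))
      spoke≡ : ∀ i j → spoke i j ≡ ind i₀ i * (ind j₀ j * 2)
      spoke≡ i j rewrite ind-old-new (endˡ i) i₀ j₀ | ind-old-new (endʳ i) i₀ j₀
                       | ind-new i j i₀ j₀ | ind-sym i i₀ | ind-sym j j₀ =
        solve 2 (λ a b → a :* b :+ a :* b := a :* (b :* con 2)) refl (ind i₀ i) (ind j₀ j)

  spokeDegreeSum : Fin (n G) → ℕ
  spokeDegreeSum v = (k + 1) * deg G v + 2

  HM-R : HM (R k G) ≡ (k + 1) ^ 2 * HM G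
                      + k * ∑[ e ∈ edges G ] (spokeDegreeSum (proj₁ e) ^ 2 + spokeDegreeSum (proj₂ e) ^ 2)
  HM-R = begin
    HM (R k G)
      ≡⟨ ∑-edges (λ a b → (deg (R k G) a + deg (R k G) b) ^ 2) ⟩
    ∑[ e ∈ edges G ] ((deg (R k G) (old (proj₁ e)) + deg (R k G) (old (proj₂ e))) ^ 2)
      + ∑[ i ∈ allFin m ] ∑[ j ∈ allFin k ] spoke i j
      ≡⟨ cong₂ _+_ (trans (∑-cong (edges G) λ e → oldEdge≡ (proj₁ e) (proj₂ e)) (∑-*ˡ (edges G) ((k + 1) ^ 2) _))
                   (∑-cong (allFin m) λ i → ∑-cong (allFin k) λ j → spoke≡ i j) ⟩
    (k + 1) ^ 2 * HM G + ∑[ i ∈ allFin m ] ∑[ _ ∈ allFin k ] (spokeDegreeSum (endˡ i) ^ 2 + spokeDegreeSum (endʳ i) ^ 2)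
      ≡⟨ cong ((k + 1) ^ 2 * HM G +_)
              (∑-allFin-lookup-repeated (edges G) k (λ e → spokeDegreeSum (proj₁ e) ^ 2 + spokeDegreeSum (proj₂ e) ^ 2)) ⟩
    (k + 1) ^ 2 * HM G + k * ∑[ e ∈ edges G ] (spokeDegreeSum (proj₁ e) ^ 2 + spokeDegreeSum (proj₂ e) ^ 2) ∎
    where
      open ≡-Reasoning
      oldEdge≡ : ∀ a b → (deg (R k G) (old a) + deg (R k G) (old b)) ^ 2 ≡ (k + 1) ^ 2 * (deg G a + deg G b) ^ 2
      oldEdge≡ a b rewrite deg-old a | deg-old b =
        solve 3 (λ c x y → (c :* x :+ c :* y) :^ 2 := c :^ 2 :* (x :+ y) :^ 2) refl (k + 1) (deg G a) (deg G b)
      spoke : Fin m → Fin k → ℕ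
      spoke i j = (deg (R k G) (old (endˡ i)) + deg (R k G) (new i j)) ^ 2
                + (deg (R k G) (old (endʳ i)) + deg (R k G) (new i j)) ^ 2
      spoke≡ : ∀ i j → spoke i j ≡ spokeDegreeSum (endˡ i) ^ 2 + spokeDegreeSum (endʳ i) ^ 2
      spoke≡ i j rewrite deg-old (endˡ i) | deg-old (endʳ i) | deg-new i j = refl

  ∑-deg-*-spokeDegreeSum² :
    ∑[ v ∈ allFin (n G) ] (deg G v * spokeDegreeSum v ^ 2) ≡ (k + 1) ^ 2 * F G + 4 * (k + 1) * M1 G + 4 * (2 * m)
  ∑-deg-*-spokeDegreeSum² = begin
    ∑[ v ∈ allFin (n G) ] (deg G v * spokeDegreeSum v ^ 2)
      ≡⟨ ∑-cong (allFin (n G)) (λ v → expand (deg G v)) ⟩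
    ∑[ v ∈ allFin (n G) ] ((k + 1) ^ 2 * deg G v ^ 3 + 4 * (k + 1) * deg G v ^ 2 + 4 * (deg G v * 1))
      ≡⟨ trans (∑-+ (allFin (n G)) _ _) (cong₂ _+_ (∑-+ (allFin (n G)) _ _) (∑-*ˡ (allFin (n G)) 4 _)) ⟩
    ∑[ v ∈ allFin (n G) ] ((k + 1) ^ 2 * deg G v ^ 3) + ∑[ v ∈ allFin (n G) ] (4 * (k + 1) * deg G v ^ 2)
      + 4 * ∑[ v ∈ allFin (n G) ] (deg G v * 1)
      ≡⟨ cong₂ _+_ (cong₂ _+_ (∑-*ˡ (allFin (n G)) ((k + 1) ^ 2) _) (∑-*ˡ (allFin (n G)) (4 * (k + 1)) _))
                   (cong (4 *_) (∑-deg G)) ⟩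
    (k + 1) ^ 2 * F G + 4 * (k + 1) * M1 G + 4 * (2 * m) ∎
    where
      open ≡-Reasoning
      expand : ∀ d → d * ((k + 1) * d + 2) ^ 2 ≡ (k + 1) ^ 2 * d ^ 3 + 4 * (k + 1) * d ^ 2 + 4 * (d * 1)
      expand = solve 2 (λ k d → d :* ((k :+ con 1) :* d :+ con 2) :^ 2
                                := (k :+ con 1) :^ 2 :* d :^ 3 :+ con 4 :* (k :+ con 1) :* d :^ 2 :+ con 4 :* (d :* con 1))
                       refl k

-- The identity holds for every graph and every k; simplicity, connectivity and k ≥ 1 are unused.
theorem2p13 : (G : Graph) → Simple G → Connected G → (k : ℕ) → k ≥ 1 →
    HM (R k G) ≡ (k + 1) ^ 2 * HM G + k * (k + 1) ^ 2 * F G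
                 + 4 * k * (k + 1) * M1 G + 8 * k * numEdges G
theorem2p13 G _ _ k _ = begin
  HM (R k G)
    ≡⟨ HM-R ⟩
  (k + 1) ^ 2 * HM G + k * ∑[ e ∈ edges G ] (spokeDegreeSum (proj₁ e) ^ 2 + spokeDegreeSum (proj₂ e) ^ 2)
    ≡⟨ cong (λ s → (k + 1) ^ 2 * HM G + k * s) (handshake G (λ v → spokeDegreeSum v ^ 2)) ⟩
  (k + 1) ^ 2 * HM G + k * ∑[ v ∈ allFin (n G) ] (deg G v * spokeDegreeSum v ^ 2)
    ≡⟨ cong (λ s → (k + 1) ^ 2 * HM G + k * s) ∑-deg-*-spokeDegreeSum² ⟩
  (k + 1) ^ 2 * HM G + k * ((k + 1) ^ 2 * F G + 4 * (k + 1) * M1 G + 4 * (2 * numEdges G))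
    ≡⟨ regroup k (HM G) (F G) (M1 G) (numEdges G) ⟩
  (k + 1) ^ 2 * HM G + k * (k + 1) ^ 2 * F G + 4 * k * (k + 1) * M1 G + 8 * k * numEdges G ∎
  where
    open ≡-Reasoning
    open SemiTotal G k
    regroup : ∀ k h f q m → (k + 1) ^ 2 * h + k * ((k + 1) ^ 2 * f + 4 * (k + 1) * q + 4 * (2 * m))
                          ≡ (k + 1) ^ 2 * h + k * (k + 1) ^ 2 * f + 4 * k * (k + 1) * q + 8 * k * m
    regroup = solve 5 (λ k h f q m →
      (k :+ con 1) :^ 2 :* h :+ k :* ((k :+ con 1) :^ 2 :* f :+ con 4 :* (k :+ con 1) :* q :+ con 4 :* (con 2 :* m))
      := (k :+ con 1) :^ 2 :* h :+ k :* (k :+ con 1) :^ 2 :* f :+ con 4 :* k :* (k :+ con 1) :* q :+ con 8 :* k :* m)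
      refl
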